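{- Let $m\ge3$ be odd, $q=2^i$ with $\gcd(i,m)=1$, and $a\in\mathbb{F}_{2^m}^*$. Define $H_a:\mathbb{F}_{2^m}^3\to\mathbb{F}_{2^m}^3$ by \[H_a(x,y,z)=\bigl(x^{q+1}+axy^q+yz^q,\; xy^q+z^{q+1},\; x^qz+y^{q+1}+ay^qz\bigr).\] Then $H_a$ is a permutation of $\mathbb{F}_{2^m}^3$ if and only if $P_a'(T)=T^{q^2+q+1}+aT^{q^2+q}+1$ has no roots in $\mathbb{F}_{2^m}$.
   Context: $\mathbb{F}_{2^m}$ is the finite field with $2^m$ elements. -}

module Defs where

open import Data.Nat using (ℕ; zero; suc)
import Data.Nat as ℕ
open import Data.Fin using (Fin)
open import Data.Product using (∃; _×_; _,_)
open import Relation.Binary.PropositionalEquality using (_≡_)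
open import Relation.Nullary using (¬_)
open import Algebra.Core using (Op₁; Op₂)
open import Algebra.Structures using (IsCommutativeRing)
open import Function.Bundles using (_↔_)

record Field : Set₁ where
  infixl 7 _*_
  infixl 6 _+_
  field
    Carrier : Set
    _+_ _*_ : Op₂ Carrier
    -_      : Op₁ Carrier
    0# 1#   : Carrier
    isCommutativeRing : IsCommutativeRing _≡_ _+_ _*_ -_ 0# 1#
    0≢1     : ¬ (0# ≡ 1#)
    inverse : ∀ x → ¬ (x ≡ 0#) → ∃ λ y → x * y ≡ 1#

  infixr 8 _^_
  _^_ : Carrier → ℕ → Carrier
  x ^ zero  = 1#
  x ^ suc n = x * (x ^ n)

HasOrder : Field → ℕ → Set
HasOrder F n = Field.Carrier F ↔ Fin n

H : (F : Field) → (q : ℕ) → Field.Carrier F →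
    Field.Carrier F × Field.Carrier F × Field.Carrier F →
    Field.Carrier F × Field.Carrier F × Field.Carrier F
H F q a (x , y , z) =
  ( x ^ suc q + a * x * y ^ q + y * z ^ q
  , x * y ^ q + z ^ suc q
  , x ^ q * z + y ^ suc q + a * y ^ q * z )
  where open Field F

P′ : (F : Field) → (q : ℕ) → Field.Carrier F → Field.Carrier F → Field.Carrier F
P′ F q a T = T ^ (q ℕ.* q ℕ.+ q ℕ.+ 1) + a * T ^ (q ℕ.* q ℕ.+ q) + 1#
  where open Field F

{-# OPTIONS --safe #-}
-- If P′ₐ(t) = 0 then Hₐ(t ^ -q, t, 1) = 0 = Hₐ(0, 0, 0), so Hₐ is not injective.
-- Conversely, assume P′ₐ has no root. Since F³ is finite it suffices that Hₐ is injective.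
-- Write φ x = x ^ q, an automorphism of F. A nonzero (x, y, z) in the kernel of Hₐ would make
-- y / z a root of P′ₐ. For p = Hₐ v ≠ 0, the vector φ v is orthogonal to two vectors that
-- depend on p only, hence parallel to their cross product normal p. When normal p ≠ 0,
-- Hₐ v = Hₐ w thus forces w = l v with l ^ (q + 1) = 1, so l = 1 as gcd (2 i, m) = 1.
-- Finally normal p = 0 would give X ≠ 0 with L₁ X = X ^ q³ + a X ^ q² + X = 0. For the trace
-- form, L₁ is adjoint up to Frobenius twists to L₂ Y = Y ^ q³ + a Y ^ q + Y, which is
-- injective (a nonzero zero Y of L₂ makes Y ^ (1 - q) a root of P′ₐ), hence onto; then the
-- trace would vanish on F, impossible for a polynomial of degree 2 ^ (m - 1) < |F|.
module Submission where

open import Defs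
open import Data.Nat as ℕ using (ℕ; zero; suc; _≤_; _<_)
import Data.Nat.Properties as ℕ
open import Data.Nat.Divisibility using (_∣_; ∣-trans)
open import Data.Nat.GCD using (gcd; gcd-GCD; gcd-identityˡ; module Bézout)
open import Data.Nat.Coprimality using (Coprime; coprime-divisor; gcd≡1⇒coprime; coprime⇒gcd≡1)
open import Data.Nat.Primality using (irreducible[2])
open import Data.Fin as Fin using (Fin)
import Data.Fin.Properties as Fin
import Data.Product.Properties as Product
open import Data.Parity.Base using (Parity; 0ℙ; 1ℙ)
import Data.Parity.Properties as Parity
open import Data.Maybe using (Maybe; just; nothing)
open import Data.Product using (∃; _×_; _,_; proj₁; proj₂)
open import Data.Sum using (inj₁; inj₂)
open import Function using (_∘_; Injective; StrictlySurjective; Bijective; Inverse; Injection; _↔_; mk↔ₛ′; _⇔_; mk⇔)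
open import Function.Properties.Inverse using (↔⇒↣; ↔-sym; ↔-trans; ↔-refl)
open import Function.Consequences.Propositional using (strictlySurjective⇒surjective)
open import Data.Product.Function.NonDependent.Propositional using (_×-↔_)
open import Relation.Binary.Definitions using (DecidableEquality)
open import Relation.Binary.PropositionalEquality
  using (_≡_; _≢_; refl; sym; trans; cong; cong₂; subst; subst₂; module ≡-Reasoning)
open import Relation.Nullary using (¬_; yes; no; contradiction)
open import Algebra.Bundles using (CommutativeRing; CommutativeSemiring)
open import Algebra.Structures using (IsCommutativeRing)
import Algebra.Properties.Ring as RingProperties
import Algebra.Properties.CommutativeSemigroup as CommutativeSemigroupProperties
import Algebra.Properties.CommutativeMonoid.Sum as Sum
import Algebra.Properties.Semiring.Mult as SemiringMult
import Algebra.Solver.Ring.NaturalCoefficients as NaturalCoefficients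

coprime-2* : ∀ {i m} → ¬ 2 ∣ m → Coprime i m → Coprime (2 ℕ.* i) m
coprime-2* 2∤m i⊥m {d} (d∣2i , d∣m) = i⊥m (coprime-divisor d⊥2 d∣2i , d∣m)
  where
  d⊥2 : Coprime d 2
  d⊥2 (e∣d , e∣2) with irreducible[2] e∣2
  ... | inj₁ e≡1 = e≡1
  ... | inj₂ refl = contradiction (∣-trans e∣d d∣m) 2∤m

Fin-injective⇒surjective : ∀ {n} {f : Fin n → Fin n} → Injective _≡_ _≡_ f → StrictlySurjective _≡_ f
Fin-injective⇒surjective {suc n} {f} f-inj y with Fin.any? (λ x → f x Fin.≟ y)
... | yes hit  = hit
... | no  miss = contradiction (Fin.injective⇒≤ f∖y-injective) ℕ.1+n≰n
  where
  f∖y : Fin (suc n) → Fin n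
  f∖y x = Fin.punchOut {i = y} (λ y≡fx → miss (x , sym y≡fx))
  f∖y-injective : Injective _≡_ _≡_ f∖y
  f∖y-injective = f-inj ∘ Fin.punchOut-injective {i = y} _ _

↔Fin-³ : ∀ {A : Set} {n} → A ↔ Fin n → (A × A × A) ↔ Fin (n ℕ.* (n ℕ.* n))
↔Fin-³ {n = n} A↔Fin = ↔-trans (A↔Fin ×-↔ (A↔Fin ×-↔ A↔Fin))
  (↔-trans (↔-refl ×-↔ ↔-sym (Fin.*↔× {n} {n})) (↔-sym (Fin.*↔× {n} {n ℕ.* n})))

module _ {A : Set} {n : ℕ} (A↔Fin : A ↔ Fin n) where
  open Inverse A↔Fin

  finite-≟ : DecidableEquality A
  finite-≟ = Fin.inj⇒≟ (↔⇒↣ A↔Fin)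

  finite-injective⇒surjective : {f : A → A} → Injective _≡_ _≡_ f → StrictlySurjective _≡_ f
  finite-injective⇒surjective {f} f-inj y =
    let i , eq = Fin-injective⇒surjective to∘f∘from-injective (to y) in from i , to-injective eq
    where
    to-injective : Injective _≡_ _≡_ to
    to-injective {a} {b} eq = trans (sym (strictlyInverseʳ a)) (trans (cong from eq) (strictlyInverseʳ b))
    to∘f∘from-injective : Injective _≡_ _≡_ (to ∘ f ∘ from)
    to∘f∘from-injective {i} {j} eq =
      trans (sym (strictlyInverseˡ i)) (trans (cong to (f-inj (to-injective eq))) (strictlyInverseˡ j))

module FieldProperties (F : Field) where

  open Field F public
  open IsCommutativeRing isCommutativeRing public
    using (+-assoc; +-identityˡ; +-identityʳ; -‿inverseʳ;
           *-assoc; *-comm; *-identityˡ; *-identityʳ; zeroˡ; zeroʳ)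

  commutativeRing : CommutativeRing _ _
  commutativeRing = record { isCommutativeRing = isCommutativeRing }

  open CommutativeRing commutativeRing public
    using (commutativeSemiring; *-commutativeMonoid; *-commutativeSemigroup)
  open CommutativeSemigroupProperties *-commutativeSemigroup public
    using () renaming (interchange to *-interchange)

  -1*-1≡1 : - 1# * - 1# ≡ 1#
  -1*-1≡1 = trans (-1*x≈-x (- 1#)) (-‿involutive 1#)
    where open RingProperties (CommutativeRing.ring commutativeRing)

  1≢0 : 1# ≢ 0#
  1≢0 = 0≢1 ∘ sym

  ^-distribˡ-+-* : ∀ x k l → x ^ (k ℕ.+ l) ≡ x ^ k * x ^ l
  ^-distribˡ-+-* x zero    l = sym (*-identityˡ _)
  ^-distribˡ-+-* x (suc k) l = trans (cong (x *_) (^-distribˡ-+-* x k l)) (sym (*-assoc _ _ _))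

  ^-distribʳ-* : ∀ x y k → (x * y) ^ k ≡ x ^ k * y ^ k
  ^-distribʳ-* x y zero    = sym (*-identityˡ _)
  ^-distribʳ-* x y (suc k) = trans (cong ((x * y) *_) (^-distribʳ-* x y k)) (*-interchange x y _ _)

  1^k≡1 : ∀ k → 1# ^ k ≡ 1#
  1^k≡1 zero    = refl
  1^k≡1 (suc k) = trans (*-identityˡ _) (1^k≡1 k)

  ^-*-assoc : ∀ x k l → (x ^ k) ^ l ≡ x ^ (k ℕ.* l)
  ^-*-assoc x zero    l = 1^k≡1 l
  ^-*-assoc x (suc k) l = begin
    (x * x ^ k) ^ l       ≡⟨ ^-distribʳ-* x (x ^ k) l ⟩
    x ^ l * (x ^ k) ^ l   ≡⟨ cong (x ^ l *_) (^-*-assoc x k l) ⟩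
    x ^ l * x ^ (k ℕ.* l) ≡⟨ ^-distribˡ-+-* x l (k ℕ.* l) ⟨
    x ^ (l ℕ.+ k ℕ.* l)   ∎
    where open ≡-Reasoning

  *-cancelˡ : ∀ {x y z} → x ≢ 0# → x * y ≡ x * z → y ≡ z
  *-cancelˡ {x} {y} {z} x≢0 xy≡xz = begin
    y              ≡⟨ *-identityˡ y ⟨
    1# * y         ≡⟨ cong (_* y) x⁻¹x≡1 ⟨
    x⁻¹ * x * y    ≡⟨ *-assoc x⁻¹ x y ⟩
    x⁻¹ * (x * y)  ≡⟨ cong (x⁻¹ *_) xy≡xz ⟩
    x⁻¹ * (x * z)  ≡⟨ *-assoc x⁻¹ x z ⟨
    x⁻¹ * x * z    ≡⟨ cong (_* z) x⁻¹x≡1 ⟩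
    1# * z         ≡⟨ *-identityˡ z ⟩
    z              ∎
    where
    open ≡-Reasoning
    x⁻¹ = proj₁ (inverse x x≢0)
    x⁻¹x≡1 : x⁻¹ * x ≡ 1#
    x⁻¹x≡1 = trans (*-comm x⁻¹ x) (proj₂ (inverse x x≢0))

  *-zero-cancelˡ : ∀ {x y} → x ≢ 0# → x * y ≡ 0# → y ≡ 0#
  *-zero-cancelˡ {x} x≢0 xy≡0 = *-cancelˡ x≢0 (trans xy≡0 (sym (zeroʳ x)))

  *-≢0 : ∀ {x y} → x ≢ 0# → y ≢ 0# → x * y ≢ 0#
  *-≢0 x≢0 y≢0 = y≢0 ∘ *-zero-cancelˡ x≢0

  ^-≢0 : ∀ {x} k → x ≢ 0# → x ^ k ≢ 0#
  ^-≢0 zero    x≢0 = 1≢0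
  ^-≢0 (suc k) x≢0 = *-≢0 x≢0 (^-≢0 k x≢0)

  divide : ∀ x {y} → y ≢ 0# → ∃ λ t → t * y ≡ x
  divide x {y} y≢0 = x * y⁻¹ , (begin
    x * y⁻¹ * y    ≡⟨ *-assoc x y⁻¹ y ⟩
    x * (y⁻¹ * y)  ≡⟨ cong (x *_) (trans (*-comm y⁻¹ y) (proj₂ (inverse y y≢0))) ⟩
    x * 1#         ≡⟨ *-identityʳ x ⟩
    x              ∎)
    where
    open ≡-Reasoning
    y⁻¹ = proj₁ (inverse y y≢0)

  x≡0⇒x+y≡0⇒y≡0 : ∀ {x y} → x ≡ 0# → x + y ≡ 0# → y ≡ 0#
  x≡0⇒x+y≡0⇒y≡0 {x} {y} x≡0 x+y≡0 = trans (sym (+-identityˡ y)) (trans (cong (_+ y) (sym x≡0)) x+y≡0)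

  y≡0⇒x+y≡0⇒x≡0 : ∀ {x y} → y ≡ 0# → x + y ≡ 0# → x ≡ 0#
  y≡0⇒x+y≡0⇒x≡0 {x} {y} y≡0 x+y≡0 = trans (sym (+-identityʳ x)) (trans (cong (x +_) (sym y≡0)) x+y≡0)

  *-identity-unique : ∀ {l x} → x ≢ 0# → l * x ≡ x → l ≡ 1#
  *-identity-unique {l} {x} x≢0 lx≡x = *-cancelˡ x≢0 (trans (*-comm x l) (trans lx≡x (sym (*-identityʳ x))))

  infixl 6 _⊕_
  infixl 7 _⊛_

  _⊕_ : ∀ {x y} → x ≡ 0# → y ≡ 0# → x + y ≡ 0#
  x≡0 ⊕ y≡0 = trans (cong₂ _+_ x≡0 y≡0) (+-identityʳ 0#)

  _⊛_ : ∀ c {x} → x ≡ 0# → c * x ≡ 0#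
  c ⊛ x≡0 = trans (cong (c *_) x≡0) (zeroʳ c)

  record Fixed (p k : ℕ) (x : Carrier) : Set where
    constructor mkFixed
    field fixed : x ^ (p ℕ.^ k) ≡ x

  open Fixed public

  fixed-0 : ∀ {p} x → Fixed p 0 x
  fixed-0 x = mkFixed (*-identityʳ x)

  fixed-+ : ∀ {p k l x} → Fixed p k x → Fixed p l x → Fixed p (k ℕ.+ l) x
  fixed-+ {p} {k} {l} {x} (mkFixed fix-k) (mkFixed fix-l) = mkFixed (begin
    x ^ (p ℕ.^ (k ℕ.+ l))         ≡⟨ cong (x ^_) (ℕ.^-distribˡ-+-* p k l) ⟩
    x ^ (p ℕ.^ k ℕ.* p ℕ.^ l)     ≡⟨ ^-*-assoc x (p ℕ.^ k) (p ℕ.^ l) ⟨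
    (x ^ (p ℕ.^ k)) ^ (p ℕ.^ l)   ≡⟨ cong (_^ (p ℕ.^ l)) fix-k ⟩
    x ^ (p ℕ.^ l)                 ≡⟨ fix-l ⟩
    x                             ∎)
    where open ≡-Reasoning

  fixed-∸ : ∀ {p k l r x} → Fixed p k x → Fixed p r x → l ℕ.+ k ≡ r → Fixed p l x
  fixed-∸ {p} {k} {l} {r} {x} (mkFixed fix-k) (mkFixed fix-r) l+k≡r = mkFixed (begin
    x ^ (p ℕ.^ l)                 ≡⟨ cong (_^ (p ℕ.^ l)) fix-k ⟨
    (x ^ (p ℕ.^ k)) ^ (p ℕ.^ l)   ≡⟨ ^-*-assoc x (p ℕ.^ k) (p ℕ.^ l) ⟩
    x ^ (p ℕ.^ k ℕ.* p ℕ.^ l)     ≡⟨ cong (x ^_) (ℕ.^-distribˡ-+-* p k l) ⟨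
    x ^ (p ℕ.^ (k ℕ.+ l))         ≡⟨ cong (λ s → x ^ (p ℕ.^ s)) (trans (ℕ.+-comm k l) l+k≡r) ⟩
    x ^ (p ℕ.^ r)                 ≡⟨ fix-r ⟩
    x                             ∎)
    where open ≡-Reasoning

  fixed-* : ∀ {p k x} c → Fixed p k x → Fixed p (c ℕ.* k) x
  fixed-* {x = x} zero    fix-k = fixed-0 x
  fixed-* {x = x} (suc c) fix-k = fixed-+ fix-k (fixed-* c fix-k)

  fixed-gcd : ∀ {p k l x} → Fixed p k x → Fixed p l x → Fixed p (gcd k l) x
  fixed-gcd {k = k} {l} fix-k fix-l with Bézout.identity (gcd-GCD k l)
  ... | Bézout.+- u v d+vl≡uk = fixed-∸ (fixed-* v fix-l) (fixed-* u fix-k) d+vl≡uk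
  ... | Bézout.-+ u v d+uk≡vl = fixed-∸ (fixed-* u fix-k) (fixed-* v fix-l) d+uk≡vl

module FiniteField (F : Field) where
  open FieldProperties F
  private module ∏ = Sum *-commutativeMonoid

  ∏-const : ∀ k x → ∏.sum {k} (λ _ → x) ≡ x ^ k
  ∏-const zero    x = refl
  ∏-const (suc k) x = cong (x *_) (∏-const k x)

  ∏-≢0 : ∀ {k} (f : Fin k → Carrier) → (∀ i → f i ≢ 0#) → ∏.sum f ≢ 0#
  ∏-≢0 {zero}  f f≢0 = 1≢0
  ∏-≢0 {suc k} f f≢0 = *-≢0 (f≢0 Fin.zero) (∏-≢0 (f ∘ Fin.suc) (f≢0 ∘ Fin.suc))

  module _ {k : ℕ} (order : Carrier ↔ Fin (suc k)) where
    open Inverse order using (to; from; strictlyInverseˡ; strictlyInverseʳ)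

    -- Lagrange's argument: the product of unit y (which is y, or 1 for y = 0) over all y is
    -- unchanged by the permutation y ↦ x * y, which multiplies it by x ^ k.
    private
      infix 4 _≟_
      _≟_ : DecidableEquality Carrier
      _≟_ = finite-≟ order

      unit : Carrier → Carrier
      unit y with y ≟ 0#
      ... | yes _ = 1#
      ... | no  _ = y

      factor : Carrier → Carrier → Carrier
      factor x y with y ≟ 0#
      ... | yes _ = 1#
      ... | no  _ = x

      unit-≢0 : ∀ y → unit y ≢ 0#
      unit-≢0 y with y ≟ 0#
      ... | yes _   = 1≢0
      ... | no  y≢0 = y≢0

      unit-* : ∀ {x} → x ≢ 0# → ∀ y → unit (x * y) ≡ factor x y * unit y
      unit-* {x} x≢0 y with y ≟ 0# | x * y ≟ 0#
      ... | yes _    | yes _    = sym (*-identityˡ 1#)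
      ... | yes refl | no xy≢0  = contradiction (zeroʳ x) xy≢0
      ... | no  y≢0  | yes xy≡0 = contradiction xy≡0 (*-≢0 x≢0 y≢0)
      ... | no  _    | no  _    = refl

      factor-0 : ∀ x → factor x 0# ≡ 1#
      factor-0 x with 0# ≟ 0#
      ... | yes _  = refl
      ... | no 0≢0 = contradiction refl 0≢0

      factor-≢0 : ∀ x {y} → y ≢ 0# → factor x y ≡ x
      factor-≢0 x {y} y≢0 with y ≟ 0#
      ... | yes y≡0 = contradiction y≡0 y≢0
      ... | no  _   = refl

      from-punchIn-≢0 : ∀ j → from (Fin.punchIn (to 0#) j) ≢ 0#
      from-punchIn-≢0 j eq =
        Fin.punchInᵢ≢i (to 0#) j (trans (sym (strictlyInverseˡ _)) (cong to eq))

      multiplication : ∀ {x} → x ≢ 0# → Fin (suc k) ↔ Fin (suc k)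
      multiplication {x} x≢0 =
        mk↔ₛ′ (λ i → to (x * from i)) (λ i → to (x⁻¹ * from i)) (cancel x x⁻¹ xx⁻¹≡1) (cancel x⁻¹ x x⁻¹x≡1)
        where
        x⁻¹ = proj₁ (inverse x x≢0)
        xx⁻¹≡1 = proj₂ (inverse x x≢0)
        x⁻¹x≡1 = trans (*-comm x⁻¹ x) xx⁻¹≡1
        cancel : ∀ u v → u * v ≡ 1# → ∀ i → to (u * from (to (v * from i))) ≡ i
        cancel u v uv≡1 i = begin
          to (u * from (to (v * from i))) ≡⟨ cong (λ w → to (u * w)) (strictlyInverseʳ _) ⟩
          to (u * (v * from i))           ≡⟨ cong to (*-assoc u v _) ⟨
          to (u * v * from i)             ≡⟨ cong (λ w → to (w * from i)) uv≡1 ⟩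
          to (1# * from i)                ≡⟨ cong to (*-identityˡ _) ⟩
          to (from i)                     ≡⟨ strictlyInverseˡ i ⟩
          i                               ∎
          where open ≡-Reasoning

      ∏-factor≡1 : ∀ {x} → x ≢ 0# → ∏.sum (factor x ∘ from) ≡ 1#
      ∏-factor≡1 {x} x≢0 = *-cancelˡ (∏-≢0 (unit ∘ from) (unit-≢0 ∘ from)) (begin
        U * ∏.sum (factor x ∘ from)                         ≡⟨ *-comm U _ ⟩
        ∏.sum (factor x ∘ from) * U                         ≡⟨ ∏.∑-distrib-+ (factor x ∘ from) (unit ∘ from) ⟨
        ∏.sum (λ i → factor x (from i) * unit (from i))     ≡⟨ ∏.sum-cong-≗ (sym ∘ unit-* x≢0 ∘ from) ⟩
        ∏.sum (λ i → unit (x * from i))                     ≡⟨ ∏.sum-cong-≗ (cong unit ∘ strictlyInverseʳ ∘ (x *_) ∘ from) ⟨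
        ∏.sum (λ i → unit (from (to (x * from i))))         ≡⟨ ∏.sum-permute (unit ∘ from) (multiplication x≢0) ⟨
        U                                                   ≡⟨ *-identityʳ U ⟨
        U * 1#                                              ∎)
        where
        open ≡-Reasoning
        U = ∏.sum (unit ∘ from)

    unit-power : ∀ {x} → x ≢ 0# → x ^ k ≡ 1#
    unit-power {x} x≢0 = begin
      x ^ k                                                ≡⟨ ∏-const k x ⟨
      ∏.sum {k} (λ _ → x)                                  ≡⟨ ∏.sum-cong-≗ (factor-≢0 x ∘ from-punchIn-≢0) ⟨
      ∏.sum (λ j → factor x (from (Fin.punchIn (to 0#) j))) ≡⟨ *-identityˡ _ ⟨
      1# * ∏⁺                                              ≡⟨ cong (_* ∏⁺) (trans (cong (factor x) (strictlyInverseʳ 0#)) (factor-0 x)) ⟨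
      factor x (from (to 0#)) * ∏⁺                         ≡⟨ ∏.sum-remove {i = to 0#} (factor x ∘ from) ⟨
      ∏.sum (factor x ∘ from)                              ≡⟨ ∏-factor≡1 x≢0 ⟩
      1#                                                   ∎
      where
      open ≡-Reasoning
      ∏⁺ = ∏.sum (λ j → factor x (from (Fin.punchIn (to 0#) j)))

  fermat : ∀ {n} → Carrier ↔ Fin n → ∀ x → x ^ n ≡ x
  fermat {zero}  order x with () ← Inverse.to order x
  fermat {suc k} order x with finite-≟ order x 0#
  ... | yes refl = zeroˡ _
  ... | no  x≢0  = trans (cong (x *_) (unit-power order x≢0)) (*-identityʳ x)

  no-field-of-order-1 : ¬ (Carrier ↔ Fin 1)
  no-field-of-order-1 order with Inverse.to order 0# in eq₀ | Inverse.to order 1# in eq₁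
  ... | Fin.zero | Fin.zero = 0≢1 (Injection.injective (↔⇒↣ order) (trans eq₀ (sym eq₁)))

  characteristic-2 : ∀ {m} → Carrier ↔ Fin (2 ℕ.^ m) → 1# + 1# ≡ 0#
  characteristic-2 {zero}  order = contradiction order no-field-of-order-1
  characteristic-2 {suc m} order = begin
    1# + 1#    ≡⟨ cong (1# +_) -1≡1 ⟨
    1# + - 1#  ≡⟨ -‿inverseʳ 1# ⟩
    0#         ∎
    where
    open ≡-Reasoning
    -1≡1 : - 1# ≡ 1#
    -1≡1 = begin
      - 1#                       ≡⟨ fermat order (- 1#) ⟨
      (- 1#) ^ (2 ℕ.* 2 ℕ.^ m)   ≡⟨ ^-*-assoc (- 1#) 2 (2 ℕ.^ m) ⟨
      ((- 1#) ^ 2) ^ (2 ℕ.^ m)   ≡⟨ cong (_^ (2 ℕ.^ m)) (trans (cong (- 1# *_) (*-identityʳ _)) -1*-1≡1) ⟩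
      1# ^ (2 ℕ.^ m)             ≡⟨ 1^k≡1 (2 ℕ.^ m) ⟩
      1#                         ∎

module Characteristic2 (F : Field) (1+1≡0 : Field._+_ F (Field.1# F) (Field.1# F) ≡ Field.0# F) where
  open FieldProperties F public

  private
    open SemiringMult (CommutativeSemiring.semiring commutativeSemiring) using () renaming (_×_ to _×ₙ_)

    ⟦_⟧ : Parity → ℕ
    ⟦ 0ℙ ⟧ = 0
    ⟦ 1ℙ ⟧ = 1

    ×1≡parity : ∀ k → k ×ₙ 1# ≡ ⟦ ℕ.parity k ⟧ ×ₙ 1#
    ×1≡parity zero          = refl
    ×1≡parity (suc zero)    = refl
    ×1≡parity (suc (suc k)) = begin
      1# + (1# + k ×ₙ 1#)  ≡⟨ +-assoc 1# 1# _ ⟨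
      1# + 1# + k ×ₙ 1#    ≡⟨ cong (_+ k ×ₙ 1#) 1+1≡0 ⟩
      0# + k ×ₙ 1#         ≡⟨ +-identityˡ _ ⟩
      k ×ₙ 1#              ≡⟨ ×1≡parity k ⟩
      _                   ∎
      where open ≡-Reasoning

    ×1-≟ : ∀ k l → Maybe (k ×ₙ 1# ≡ l ×ₙ 1#)
    ×1-≟ k l with ℕ.parity k Parity.≟ ℕ.parity l
    ... | yes same = just (trans (×1≡parity k) (trans (cong (λ π → ⟦ π ⟧ ×ₙ 1#) same) (sym (×1≡parity l))))
    ... | no  _    = nothing

  module Solver = NaturalCoefficients commutativeSemiring ×1-≟
  open Solver public using (solve; _:+_; _:*_; _:=_; con)

  x+x≡0 : ∀ x → x + x ≡ 0#
  x+x≡0 x = trans (solve 1 (λ x → x :+ x := (con 1 :+ con 1) :* x) refl x) (trans (cong (_* x) 1+1≡0) (zeroˡ x))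

  x+y≡0⇒x≡y : ∀ {x y} → x + y ≡ 0# → x ≡ y
  x+y≡0⇒x≡y {x} {y} x+y≡0 = begin
    x            ≡⟨ solve 2 (λ x y → x := (x :+ y) :+ y) refl x y ⟩
    (x + y) + y  ≡⟨ cong (_+ y) x+y≡0 ⟩
    0# + y       ≡⟨ +-identityˡ y ⟩
    y            ∎
    where open ≡-Reasoning

  x≡y⇒x+y≡0 : ∀ {x y} → x ≡ y → x + y ≡ 0#
  x≡y⇒x+y≡0 {x} refl = x+x≡0 x

  +-cancelʳ : ∀ {x y} z → x + z ≡ y + z → x ≡ y
  +-cancelʳ {x} {y} z eq = x+y≡0⇒x≡y (begin
    x + y              ≡⟨ solve 3 (λ x y z → x :+ y := (x :+ z) :+ (y :+ z)) refl x y z ⟩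
    (x + z) + (y + z)  ≡⟨ x≡y⇒x+y≡0 eq ⟩
    0#                 ∎)
    where open ≡-Reasoning

  additive⇒0↦0 : ∀ {f : Carrier → Carrier} → (∀ x y → f (x + y) ≡ f x + f y) → f 0# ≡ 0#
  additive⇒0↦0 {f} f-+ = trans (cong f (sym (+-identityˡ 0#))) (trans (f-+ 0# 0#) (x+x≡0 (f 0#)))

  frobenius-+ : ∀ k x y → (x + y) ^ (2 ℕ.^ k) ≡ x ^ (2 ℕ.^ k) + y ^ (2 ℕ.^ k)
  frobenius-+ zero    x y = solve 2 (λ x y → (x :+ y) :* con 1 := x :* con 1 :+ y :* con 1) refl x y
  frobenius-+ (suc k) x y = begin
    (x + y) ^ (2 ℕ.* 2 ℕ.^ k)              ≡⟨ ^-*-assoc (x + y) 2 (2 ℕ.^ k) ⟨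
    ((x + y) ^ 2) ^ (2 ℕ.^ k)              ≡⟨ cong (_^ (2 ℕ.^ k)) square-+ ⟩
    (x ^ 2 + y ^ 2) ^ (2 ℕ.^ k)            ≡⟨ frobenius-+ k (x ^ 2) (y ^ 2) ⟩
    (x ^ 2) ^ (2 ℕ.^ k) + (y ^ 2) ^ (2 ℕ.^ k) ≡⟨ cong₂ _+_ (^-*-assoc x 2 (2 ℕ.^ k)) (^-*-assoc y 2 (2 ℕ.^ k)) ⟩
    x ^ (2 ℕ.* 2 ℕ.^ k) + y ^ (2 ℕ.* 2 ℕ.^ k) ∎
    where
    open ≡-Reasoning
    square-+ : (x + y) ^ 2 ≡ x ^ 2 + y ^ 2
    square-+ = solve 2 (λ x y → (x :+ y) :* ((x :+ y) :* con 1) := x :* (x :* con 1) :+ y :* (y :* con 1)) refl x y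

  -- Poly d c f: f is a polynomial function of degree ≤ d with coefficient c at w ^ d, given
  -- through its division with remainder by w + r (that is, w - r) for every r.
  data Poly : ℕ → Carrier → (Carrier → Carrier) → Set where
    constant   : ∀ {c f} → (∀ w → f w ≡ c) → Poly zero c f
    byDivision : ∀ {d c f} →
                 (∀ r → ∃ λ g → Poly d c g × (∀ w → f w ≡ (w + r) * g w + f r)) → Poly (suc d) c f

  poly-cong : ∀ {d c f g} → Poly d c f → (∀ w → f w ≡ g w) → Poly d c g
  poly-cong (constant f≡c) f≗g = constant (λ w → trans (sym (f≗g w)) (f≡c w))
  poly-cong (byDivision div) f≗g = byDivision λ r → let h , poly-h , f≡ = div r in
    h , poly-h , λ w → trans (sym (f≗g w)) (trans (f≡ w) (cong (λ u → (w + r) * h w + u) (f≗g r)))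

  poly-+ : ∀ {d c c′ f f′} → Poly d c f → Poly d c′ f′ → Poly d (c + c′) (λ w → f w + f′ w)
  poly-+ (constant f≡c) (constant f′≡c′) = constant (λ w → cong₂ _+_ (f≡c w) (f′≡c′ w))
  poly-+ {f = f} {f′} (byDivision div) (byDivision div′) = byDivision λ r →
    let g , poly-g , f≡ = div r ; g′ , poly-g′ , f′≡ = div′ r in
    (λ w → g w + g′ w) , poly-+ poly-g poly-g′ , λ w →
      trans (cong₂ _+_ (f≡ w) (f′≡ w))
        (solve 6 (λ w r g g′ a a′ → ((w :+ r) :* g :+ a) :+ ((w :+ r) :* g′ :+ a′)
                                   := (w :+ r) :* (g :+ g′) :+ (a :+ a′)) refl w r (g w) (g′ w) (f r) (f′ r))

  poly-*ˡ : ∀ {d c f} k → Poly d c f → Poly d (k * c) (λ w → k * f w)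
  poly-*ˡ k (constant f≡c) = constant (λ w → cong (k *_) (f≡c w))
  poly-*ˡ {f = f} k (byDivision div) = byDivision λ r → let g , poly-g , f≡ = div r in
    (λ w → k * g w) , poly-*ˡ k poly-g , λ w →
      trans (cong (k *_) (f≡ w))
        (solve 5 (λ k w r g a → k :* ((w :+ r) :* g :+ a) := (w :+ r) :* (k :* g) :+ k :* a) refl k w r (g w) (f r))

  poly-lift : ∀ {d c f} → Poly d c f → Poly (suc d) 0# f
  poly-lift {f = f} (constant f≡c) = byDivision λ r → (λ _ → 0#) , constant (λ _ → refl) , λ w →
    trans (trans (f≡c w) (sym (f≡c r))) (solve 3 (λ w r a → a := (w :+ r) :* con 0 :+ a) refl w r (f r))
  poly-lift (byDivision div) = byDivision λ r → let g , poly-g , f≡ = div r in g , poly-lift poly-g , f≡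

  poly-weaken : ∀ {d e c f} → Poly d c f → d ℕ.<′ e → Poly e 0# f
  poly-weaken p ℕ.<′-base          = poly-lift p
  poly-weaken p (ℕ.<′-step d<′e)   = poly-lift (poly-weaken p d<′e)

  poly-x* : ∀ {d c f} → Poly d c f → Poly (suc d) c (λ w → w * f w)
  poly-x* {c = c} {f} (constant f≡c) = byDivision λ r → f , constant f≡c , λ w →
    trans (cong (w *_) (f≡c w))
      (trans (solve 3 (λ w r c → w :* c := (w :+ r) :* c :+ r :* c) refl w r c)
        (cong₂ (λ u v → (w + r) * u + r * v) (sym (f≡c w)) (sym (f≡c r))))
  poly-x* {c = c} {f} (byDivision div) = byDivision λ r → let g , poly-g , f≡ = div r in
    (λ w → f w + r * g w) ,
    subst (λ c′ → Poly _ c′ _) (+-identityʳ c) (poly-+ (byDivision div) (poly-lift (poly-*ˡ r poly-g))) ,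
    λ w → trans (cong (w *_) (f≡ w))
      (trans (solve 4 (λ w r g a → w :* ((w :+ r) :* g :+ a)
                                   := (w :+ r) :* (((w :+ r) :* g :+ a) :+ r :* g) :+ r :* a) refl w r (g w) (f r))
        (cong (λ u → (w + r) * (u + r * g w) + r * f r) (sym (f≡ w))))

  poly-^ : ∀ k → Poly k 1# (_^ k)
  poly-^ zero    = constant (λ _ → refl)
  poly-^ (suc k) = poly-x* (poly-^ k)

  poly-roots≤degree : ∀ {d c f} → Poly d c f → c ≢ 0# → ∀ {k} (root : Fin k → Carrier) →
                      Injective _≡_ _≡_ root → (∀ j → f (root j) ≡ 0#) → k ≤ d
  poly-roots≤degree _ _ {zero} _ _ _ = ℕ.z≤n
  poly-roots≤degree (constant f≡c) c≢0 {suc k} root _ f[root]≡0 =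
    contradiction (trans (sym (f≡c (root Fin.zero))) (f[root]≡0 Fin.zero)) c≢0
  poly-roots≤degree {f = f} (byDivision div) c≢0 {suc k} root root-inj f[root]≡0 =
    ℕ.s≤s (poly-roots≤degree poly-g c≢0 (root ∘ Fin.suc) (Fin.suc-injective ∘ root-inj) g[root]≡0)
    where
    r₀ = root Fin.zero
    g = proj₁ (div r₀)
    poly-g = proj₁ (proj₂ (div r₀))
    f≡ = proj₂ (proj₂ (div r₀))
    g[root]≡0 : ∀ j → g (root (Fin.suc j)) ≡ 0#
    g[root]≡0 j = *-zero-cancelˡ w+r₀≢0 (begin
      (w + r₀) * g w            ≡⟨ +-identityʳ _ ⟨
      (w + r₀) * g w + 0#       ≡⟨ cong ((w + r₀) * g w +_) (f[root]≡0 Fin.zero) ⟨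
      (w + r₀) * g w + f r₀     ≡⟨ f≡ w ⟨
      f w                       ≡⟨ f[root]≡0 (Fin.suc j) ⟩
      0#                        ∎)
      where
      open ≡-Reasoning
      w = root (Fin.suc j)
      w+r₀≢0 : w + r₀ ≢ 0#
      w+r₀≢0 = (λ ()) ∘ root-inj ∘ x+y≡0⇒x≡y

  Carrier³ : Set
  Carrier³ = Carrier × Carrier × Carrier

  0⃗ : Carrier³
  0⃗ = 0# , 0# , 0#

  infixr 7 _*ᵛ_
  _*ᵛ_ : Carrier → Carrier³ → Carrier³
  l *ᵛ (x , y , z) = l * x , l * y , l * z

  infix 7 _∙_
  _∙_ : Carrier³ → Carrier³ → Carrier
  (a₁ , a₂ , a₃) ∙ (v₁ , v₂ , v₃) = a₁ * v₁ + a₂ * v₂ + a₃ * v₃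

  -- In characteristic 2 the cross product has no signs.
  infix 7 _⨯_
  _⨯_ : Carrier³ → Carrier³ → Carrier³
  (a₁ , a₂ , a₃) ⨯ (b₁ , b₂ , b₃) = a₂ * b₃ + a₃ * b₂ , a₃ * b₁ + a₁ * b₃ , a₁ * b₂ + a₂ * b₁

  rotate : Carrier³ → Carrier³
  rotate (x , y , z) = y , z , x

  infix 4 _∥₁₂_ _∥_
  _∥₁₂_ : Carrier³ → Carrier³ → Set
  (u₁ , u₂ , _) ∥₁₂ (v₁ , v₂ , _) = u₁ * v₂ ≡ u₂ * v₁

  _∥_ : Carrier³ → Carrier³ → Set
  u ∥ v = u ∥₁₂ v × rotate u ∥₁₂ rotate v × rotate (rotate u) ∥₁₂ rotate (rotate v)

  data Nonzero : Carrier³ → Set where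
    nonzero₁ : ∀ {x y z} → x ≢ 0# → Nonzero (x , y , z)
    nonzero₂ : ∀ {x y z} → y ≢ 0# → Nonzero (x , y , z)
    nonzero₃ : ∀ {x y z} → z ≢ 0# → Nonzero (x , y , z)

  nonzero⇒≢0⃗ : ∀ {v} → Nonzero v → v ≢ 0⃗
  nonzero⇒≢0⃗ (nonzero₁ x≢0) = x≢0 ∘ cong proj₁
  nonzero⇒≢0⃗ (nonzero₂ y≢0) = y≢0 ∘ cong (proj₁ ∘ proj₂)
  nonzero⇒≢0⃗ (nonzero₃ z≢0) = z≢0 ∘ cong (proj₂ ∘ proj₂)

  ∥-rotate : ∀ {u v} → u ∥ v → rotate u ∥ rotate v
  ∥-rotate (eq₁₂ , eq₂₃ , eq₃₁) = eq₂₃ , eq₃₁ , eq₁₂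

  ∙-rotate : ∀ a v → rotate a ∙ rotate v ≡ a ∙ v
  ∙-rotate (a₁ , a₂ , a₃) (v₁ , v₂ , v₃) =
    solve 6 (λ a₁ a₂ a₃ v₁ v₂ v₃ → a₂ :* v₂ :+ a₃ :* v₃ :+ a₁ :* v₁ := a₁ :* v₁ :+ a₂ :* v₂ :+ a₃ :* v₃)
      refl a₁ a₂ a₃ v₁ v₂ v₃

  ⊥⊥⇒∥₁₂⨯ : ∀ a b v → a ∙ v ≡ 0# → b ∙ v ≡ 0# → v ∥₁₂ a ⨯ b
  ⊥⊥⇒∥₁₂⨯ (a₁ , a₂ , a₃) (b₁ , b₂ , b₃) (v₁ , v₂ , v₃) a∙v≡0 b∙v≡0 =
    x+y≡0⇒x≡y (trans (solve 9 (λ a₁ a₂ a₃ b₁ b₂ b₃ v₁ v₂ v₃ →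
                 v₁ :* (a₃ :* b₁ :+ a₁ :* b₃) :+ v₂ :* (a₂ :* b₃ :+ a₃ :* b₂)
                 := a₃ :* (b₁ :* v₁ :+ b₂ :* v₂ :+ b₃ :* v₃) :+ b₃ :* (a₁ :* v₁ :+ a₂ :* v₂ :+ a₃ :* v₃))
               refl a₁ a₂ a₃ b₁ b₂ b₃ v₁ v₂ v₃) (a₃ ⊛ b∙v≡0 ⊕ b₃ ⊛ a∙v≡0))

  ⊥⊥⇒∥⨯ : ∀ a b v → a ∙ v ≡ 0# → b ∙ v ≡ 0# → v ∥ a ⨯ b
  ⊥⊥⇒∥⨯ a b v a∙v≡0 b∙v≡0 =
      ⊥⊥⇒∥₁₂⨯ a b v a∙v≡0 b∙v≡0
    , ⊥⊥⇒∥₁₂⨯ (rotate a) (rotate b) (rotate v) (⊥-rotate a∙v≡0) (⊥-rotate b∙v≡0)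
    , ⊥⊥⇒∥₁₂⨯ (rotate (rotate a)) (rotate (rotate b)) (rotate (rotate v))
              (⊥-rotate (⊥-rotate a∙v≡0)) (⊥-rotate (⊥-rotate b∙v≡0))
    where
    ⊥-rotate : ∀ {c w} → c ∙ w ≡ 0# → rotate c ∙ rotate w ≡ 0#
    ⊥-rotate {c} {w} = trans (∙-rotate c w)

  ∥-sym : ∀ {u v} → u ∥ v → v ∥ u
  ∥-sym (e₁ , e₂ , e₃) = flip e₁ , flip e₂ , flip e₃
    where
    flip : ∀ {x y z w} → x * y ≡ z * w → w * z ≡ y * x
    flip {x} {y} {z} {w} e = trans (*-comm w z) (trans (sym e) (*-comm x y))

  *ᵛ-∥ : ∀ α β w → α *ᵛ w ∥ β *ᵛ w
  *ᵛ-∥ α β (w₁ , w₂ , w₃) = minor w₁ w₂ , minor w₂ w₃ , minor w₃ w₁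
    where
    minor : ∀ x y → α * x * (β * y) ≡ α * y * (β * x)
    minor = solve 4 (λ α β x y → α :* x :* (β :* y) := α :* y :* (β :* x)) refl α β

  private
    ∥⇒*ᵛ₁ : ∀ {u₁ u₂ u₃ v₁ v₂ v₃} → u₁ ≢ 0# → (u₁ , u₂ , u₃) ∥ (v₁ , v₂ , v₃) →
            ∃ λ l → (v₁ , v₂ , v₃) ≡ l *ᵛ (u₁ , u₂ , u₃)
    ∥⇒*ᵛ₁ {u₁} {u₂} {u₃} {v₁} {v₂} {v₃} u₁≢0 (u₁v₂≡u₂v₁ , _ , u₃v₁≡u₁v₃) =
      l , cong₂ _,_ (sym lu₁≡v₁)
            (cong₂ _,_ (*-cancelˡ u₁≢0 (shift u₂ u₁v₂≡u₂v₁)) (*-cancelˡ u₁≢0 (shift u₃ (sym u₃v₁≡u₁v₃))))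
      where
      l = proj₁ (divide v₁ u₁≢0)
      lu₁≡v₁ = proj₂ (divide v₁ u₁≢0)
      shift : ∀ {v} u → u₁ * v ≡ u * v₁ → u₁ * v ≡ u₁ * (l * u)
      shift {v} u eq = trans eq (trans (cong (u *_) (sym lu₁≡v₁))
                                       (solve 3 (λ u l u₁ → u :* (l :* u₁) := u₁ :* (l :* u)) refl u l u₁))

  ∥⇒*ᵛ : ∀ {u v} → Nonzero u → u ∥ v → ∃ λ l → v ≡ l *ᵛ u
  ∥⇒*ᵛ (nonzero₁ u₁≢0) u∥v = ∥⇒*ᵛ₁ u₁≢0 u∥v
  ∥⇒*ᵛ (nonzero₂ u₂≢0) u∥v =
    let l , eq = ∥⇒*ᵛ₁ u₂≢0 (∥-rotate u∥v) in l , cong (rotate ∘ rotate) eq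
  ∥⇒*ᵛ (nonzero₃ u₃≢0) u∥v =
    let l , eq = ∥⇒*ᵛ₁ u₃≢0 (∥-rotate (∥-rotate u∥v)) in l , cong rotate eq

  ∥-trans : ∀ {u v w} → Nonzero w → u ∥ w → v ∥ w → u ∥ v
  ∥-trans {u} {v} {w} w≠0 u∥w v∥w =
    let α , u≡αw = ∥⇒*ᵛ w≠0 (∥-sym u∥w) ; β , v≡βw = ∥⇒*ᵛ w≠0 (∥-sym v∥w) in
    subst₂ _∥_ (sym u≡αw) (sym v≡βw) (*ᵛ-∥ α β w)

  *ᵛ-identityˡ : ∀ v → 1# *ᵛ v ≡ v
  *ᵛ-identityˡ (x , y , z) = cong₂ _,_ (*-identityˡ x) (cong₂ _,_ (*-identityˡ y) (*-identityˡ z))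

  *ᵛ-identity-unique : ∀ {l v} → Nonzero v → l *ᵛ v ≡ v → l ≡ 1#
  *ᵛ-identity-unique (nonzero₁ x≢0) lv≡v = *-identity-unique x≢0 (cong proj₁ lv≡v)
  *ᵛ-identity-unique (nonzero₂ y≢0) lv≡v = *-identity-unique y≢0 (cong (proj₁ ∘ proj₂) lv≡v)
  *ᵛ-identity-unique (nonzero₃ z≢0) lv≡v = *-identity-unique z≢0 (cong (proj₂ ∘ proj₂) lv≡v)

module GaloisField (F : Field) (m : ℕ) (order : Field.Carrier F ↔ Fin (2 ℕ.^ m)) where
  open FiniteField F using (fermat; characteristic-2; no-field-of-order-1)
  open Characteristic2 F (characteristic-2 {m} order) public

  infix 4 _≟_
  _≟_ : DecidableEquality Carrier
  _≟_ = finite-≟ order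

  infix 4 _≟³_
  _≟³_ : DecidableEquality Carrier³
  _≟³_ = Product.≡-dec _≟_ (Product.≡-dec _≟_ _≟_)

  ≢0⃗⇒Nonzero : ∀ {v} → v ≢ 0⃗ → Nonzero v
  ≢0⃗⇒Nonzero {x , y , z} v≢0 with x ≟ 0# | y ≟ 0# | z ≟ 0#
  ... | no  x≢0 | _         | _         = nonzero₁ x≢0
  ... | yes _   | no  y≢0   | _         = nonzero₂ y≢0
  ... | yes _   | yes _     | no  z≢0   = nonzero₃ z≢0
  ... | yes refl | yes refl | yes refl  = contradiction refl v≢0

  injective⇒surjective : ∀ {f : Carrier → Carrier} → Injective _≡_ _≡_ f → StrictlySurjective _≡_ f
  injective⇒surjective = finite-injective⇒surjective order

  ^≡0⇒≡0 : ∀ {x} k → x ^ k ≡ 0# → x ≡ 0#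
  ^≡0⇒≡0 {x} k xᵏ≡0 with x ≟ 0#
  ... | yes x≡0 = x≡0
  ... | no  x≢0 = contradiction xᵏ≡0 (^-≢0 k x≢0)

  frobenius-injective : ∀ k {x y} → x ^ (2 ℕ.^ k) ≡ y ^ (2 ℕ.^ k) → x ≡ y
  frobenius-injective k {x} {y} eq =
    x+y≡0⇒x≡y (^≡0⇒≡0 (2 ℕ.^ k) (trans (frobenius-+ k x y) (x≡y⇒x+y≡0 eq)))

  frobenius-period : ∀ x → x ^ (2 ℕ.^ m) ≡ x
  frobenius-period = fermat order

  fixed-coprime⇒≡1 : ∀ {k x} → gcd k m ≡ 1 → x ≢ 0# → Fixed 2 k x → x ≡ 1#
  fixed-coprime⇒≡1 {k} {x} k⊥m x≢0 fix-k = *-identity-unique x≢0 (begin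
    x * x         ≡⟨ cong (x *_) (*-identityʳ x) ⟨
    x ^ 2         ≡⟨ fixed (subst (λ d → Fixed 2 d x) k⊥m (fixed-gcd fix-k (mkFixed (frobenius-period x)))) ⟩
    x             ∎)
    where open ≡-Reasoning

  trace : ℕ → Carrier → Carrier
  trace zero    w = 0#
  trace (suc k) w = trace k w + w ^ (2 ℕ.^ k)

  Tr : Carrier → Carrier
  Tr = trace m

  trace-+ : ∀ k x y → trace k (x + y) ≡ trace k x + trace k y
  trace-+ zero    x y = sym (+-identityˡ 0#)
  trace-+ (suc k) x y = trans (cong₂ _+_ (trace-+ k x y) (frobenius-+ k x y))
    (solve 4 (λ u v s t → (u :+ v) :+ (s :+ t) := (u :+ s) :+ (v :+ t)) refl (trace k x) (trace k y) _ _)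

  Tr-0 : Tr 0# ≡ 0#
  Tr-0 = additive⇒0↦0 (trace-+ m)

  trace-^2 : ∀ k w → trace k (w ^ 2) + w ≡ trace k w + w ^ (2 ℕ.^ k)
  trace-^2 zero    w = cong (0# +_) (sym (*-identityʳ w))
  trace-^2 (suc k) w = begin
    trace k (w ^ 2) + (w ^ 2) ^ (2 ℕ.^ k) + w   ≡⟨ solve 3 (λ a b c → (a :+ b) :+ c := (a :+ c) :+ b) refl (trace k (w ^ 2)) _ w ⟩
    trace k (w ^ 2) + w + (w ^ 2) ^ (2 ℕ.^ k)   ≡⟨ cong₂ _+_ (trace-^2 k w) (^-*-assoc w 2 (2 ℕ.^ k)) ⟩
    trace k w + w ^ (2 ℕ.^ k) + w ^ (2 ℕ.^ suc k) ∎
    where open ≡-Reasoning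

  Tr-frobenius : ∀ k w → Tr (w ^ (2 ℕ.^ k)) ≡ Tr w
  Tr-frobenius zero    w = cong Tr (*-identityʳ w)
  Tr-frobenius (suc k) w = begin
    Tr (w ^ (2 ℕ.* 2 ℕ.^ k))    ≡⟨ cong Tr (^-*-assoc w 2 (2 ℕ.^ k)) ⟨
    Tr ((w ^ 2) ^ (2 ℕ.^ k))    ≡⟨ Tr-frobenius k (w ^ 2) ⟩
    Tr (w ^ 2)                  ≡⟨ +-cancelʳ w (trans (trace-^2 m w) (cong (Tr w +_) (frobenius-period w))) ⟩
    Tr w                        ∎
    where open ≡-Reasoning

  trace-poly : ∀ k → Poly (2 ℕ.^ k) 1# (trace (suc k))
  trace-poly zero    = poly-cong (poly-^ 1) (λ w → sym (+-identityˡ _))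
  trace-poly (suc k) = subst (λ c → Poly _ c (trace (suc (suc k)))) (+-identityˡ 1#)
    (poly-+ (poly-weaken (trace-poly k) (ℕ.<⇒<′ (ℕ.^-monoʳ-< 2 (ℕ.s≤s (ℕ.s≤s ℕ.z≤n)) (ℕ.n<1+n k)))) (poly-^ (2 ℕ.^ suc k)))

  Tr-nonvanishing : ¬ (∀ w → Tr w ≡ 0#)
  Tr-nonvanishing = trace-nonvanishing m (ℕ.n≢0⇒n>0 m≢0) ℕ.≤-refl
    where
    m≢0 : m ≢ 0
    m≢0 refl = no-field-of-order-1 order
    trace-nonvanishing : ∀ k → 0 < k → k ≤ m → ¬ (∀ w → trace k w ≡ 0#)
    trace-nonvanishing (suc k) _ k<m trace≡0 = ℕ.<⇒≱ (ℕ.^-monoʳ-< 2 (ℕ.s≤s (ℕ.s≤s ℕ.z≤n)) k<m)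
      (poly-roots≤degree (trace-poly k) 1≢0 from (Injection.injective (↔⇒↣ (↔-sym order))) (trace≡0 ∘ from))
      where open Inverse order using (from)

module PermutationCriterion (F : Field) (m : ℕ) (order : Field.Carrier F ↔ Fin (2 ℕ.^ m))
                            (i : ℕ) (a : Field.Carrier F) where
  open GaloisField F m order public

  q : ℕ
  q = 2 ℕ.^ i

  φ : Carrier → Carrier
  φ x = x ^ q

  φ-+ : ∀ x y → φ (x + y) ≡ φ x + φ y
  φ-+ = frobenius-+ i

  φ-* : ∀ x y → φ (x * y) ≡ φ x * φ y
  φ-* x y = ^-distribʳ-* x y q

  φ-*≡ : ∀ {x y z} → x * y ≡ z → φ x * φ y ≡ φ z
  φ-*≡ {x} {y} xy≡z = trans (sym (φ-* x y)) (cong φ xy≡z)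

  φ-0 : φ 0# ≡ 0#
  φ-0 = additive⇒0↦0 φ-+

  φ-1 : φ 1# ≡ 1#
  φ-1 = 1^k≡1 q

  φ-≢0 : ∀ {x} → x ≢ 0# → φ x ≢ 0#
  φ-≢0 = ^-≢0 q

  φ-injective : Injective _≡_ _≡_ φ
  φ-injective = frobenius-injective i

  x*φx≡0⇒x≡0 : ∀ {x} → x * φ x ≡ 0# → x ≡ 0#
  x*φx≡0⇒x≡0 = ^≡0⇒≡0 (suc q)

  φ-*+*≡0 : ∀ {x y u v} → x * y + u * v ≡ 0# → φ x * φ y + φ u * φ v ≡ 0#
  φ-*+*≡0 {x} {y} {u} {v} eq = begin
    φ x * φ y + φ u * φ v    ≡⟨ cong₂ _+_ (φ-* x y) (φ-* u v) ⟨
    φ (x * y) + φ (u * v)    ≡⟨ φ-+ _ _ ⟨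
    φ (x * y + u * v)        ≡⟨ cong φ eq ⟩
    φ 0#                     ≡⟨ φ-0 ⟩
    0#                       ∎
    where open ≡-Reasoning

  φ⃗ : Carrier³ → Carrier³
  φ⃗ (x , y , z) = φ x , φ y , φ z

  φ-∙ : ∀ u v → φ (u ∙ v) ≡ φ⃗ u ∙ φ⃗ v
  φ-∙ (u₁ , u₂ , u₃) (v₁ , v₂ , v₃) = begin
    φ (u₁ * v₁ + u₂ * v₂ + u₃ * v₃)              ≡⟨ φ-+ _ _ ⟩
    φ (u₁ * v₁ + u₂ * v₂) + φ (u₃ * v₃)          ≡⟨ cong₂ _+_ (φ-+ _ _) (φ-* u₃ v₃) ⟩
    φ (u₁ * v₁) + φ (u₂ * v₂) + φ u₃ * φ v₃      ≡⟨ cong₂ (λ s t → s + t + φ u₃ * φ v₃) (φ-* u₁ v₁) (φ-* u₂ v₂) ⟩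
    φ u₁ * φ v₁ + φ u₂ * φ v₂ + φ u₃ * φ v₃      ∎
    where open ≡-Reasoning

  φ⃗-∥ : ∀ {u v} → φ⃗ u ∥ φ⃗ v → u ∥ v
  φ⃗-∥ (e₁₂ , e₂₃ , e₃₁) = unφ e₁₂ , unφ e₂₃ , unφ e₃₁
    where
    unφ : ∀ {x y u v} → φ x * φ y ≡ φ u * φ v → x * y ≡ u * v
    unφ {x} {y} {u} {v} eq = φ-injective (trans (φ-* x y) (trans eq (sym (φ-* u v))))

  NoRoot : Set
  NoRoot = ¬ ∃ λ t → P′ F q a t ≡ 0#

  P′-via-φ : ∀ t → P′ F q a t ≡ φ (φ t) * φ t * t + a * (φ (φ t) * φ t) + 1#
  P′-via-φ t = cong₂ (λ u v → u + a * v + 1#) t^[q²+q+1] t^[q²+q]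
    where
    t^[q²+q] : t ^ (q ℕ.* q ℕ.+ q) ≡ φ (φ t) * φ t
    t^[q²+q] = trans (^-distribˡ-+-* t (q ℕ.* q) q) (cong (_* φ t) (sym (^-*-assoc t q q)))
    t^[q²+q+1] : t ^ (q ℕ.* q ℕ.+ q ℕ.+ 1) ≡ φ (φ t) * φ t * t
    t^[q²+q+1] = trans (^-distribˡ-+-* t (q ℕ.* q ℕ.+ q) 1) (cong₂ _*_ t^[q²+q] (*-identityʳ t))

  P′-0 : P′ F q a 0# ≡ 1#
  P′-0 = begin
    P′ F q a 0#                                          ≡⟨ P′-via-φ 0# ⟩
    φ (φ 0#) * φ 0# * 0# + a * (φ (φ 0#) * φ 0#) + 1#    ≡⟨ cong (λ u → φ u * u * 0# + a * (φ u * u) + 1#) φ-0 ⟩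
    φ 0# * 0# * 0# + a * (φ 0# * 0#) + 1#
      ≡⟨ solve 2 (λ u a → u :* con 0 :* con 0 :+ a :* (u :* con 0) :+ con 1 := con 1) refl (φ 0#) a ⟩
    1#                                                   ∎
    where open ≡-Reasoning

  Hₐ : Carrier³ → Carrier³
  Hₐ = H F q a

  H-0⃗ : Hₐ 0⃗ ≡ 0⃗
  H-0⃗ = cong₂ _,_ (solve 2 (λ u a → con 0 :* u :+ a :* con 0 :* u :+ con 0 :* u := con 0) refl (φ 0#) a)
          (cong₂ _,_ (solve 1 (λ u → con 0 :* u :+ con 0 :* u := con 0) refl (φ 0#))
                     (solve 2 (λ u a → u :* con 0 :+ con 0 :* u :+ a :* u :* con 0 := con 0) refl (φ 0#) a))

  H-homogeneous : ∀ l v → Hₐ (l *ᵛ v) ≡ (l * φ l) *ᵛ Hₐ v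
  H-homogeneous l (x , y , z)
    rewrite φ-* l x | φ-* l y | φ-* l z = cong₂ _,_
      (solve 9 (λ l L x y z X Y Z a → (l :* x) :* (L :* X) :+ a :* (l :* x) :* (L :* Y) :+ (l :* y) :* (L :* Z)
                  := (l :* L) :* (x :* X :+ a :* x :* Y :+ y :* Z)) refl l (φ l) x y z (φ x) (φ y) (φ z) a)
      (cong₂ _,_
        (solve 9 (λ l L x y z X Y Z a → (l :* x) :* (L :* Y) :+ (l :* z) :* (L :* Z)
                    := (l :* L) :* (x :* Y :+ z :* Z)) refl l (φ l) x y z (φ x) (φ y) (φ z) a)
        (solve 9 (λ l L x y z X Y Z a → (L :* X) :* (l :* z) :+ (l :* y) :* (L :* Y) :+ a :* (L :* Y) :* (l :* z)
                    := (l :* L) :* (X :* z :+ y :* Y :+ a :* Y :* z)) refl l (φ l) x y z (φ x) (φ y) (φ z) a))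

  reverse : Carrier³ → Carrier³
  reverse (x , y , z) = z , y , x

  twist : Carrier³ → Carrier³
  twist (p₁ , p₂ , p₃) = p₂ , p₁ + a * p₂ , p₃

  H-⊥-reverse : ∀ v → reverse (Hₐ v) ∙ v ≡ 0#
  H-⊥-reverse (x , y , z) = solve 7 (λ x y z X Y Z a →
    (X :* z :+ y :* Y :+ a :* Y :* z) :* x :+ (x :* Y :+ z :* Z) :* y :+ (x :* X :+ a :* x :* Y :+ y :* Z) :* z
    := con 0) refl x y z (φ x) (φ y) (φ z) a

  H-⊥-twist : ∀ v → twist (Hₐ v) ∙ φ⃗ v ≡ 0#
  H-⊥-twist (x , y , z) = solve 7 (λ x y z X Y Z a →
    (x :* Y :+ z :* Z) :* X :+ ((x :* X :+ a :* x :* Y :+ y :* Z) :+ a :* (x :* Y :+ z :* Z)) :* Y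
      :+ (X :* z :+ y :* Y :+ a :* Y :* z) :* Z
    := con 0) refl x y z (φ x) (φ y) (φ z) a

  normal : Carrier³ → Carrier³
  normal p = φ⃗ (reverse p) ⨯ twist p

  φ⃗-∥-normal : ∀ v → φ⃗ v ∥ normal (Hₐ v)
  φ⃗-∥-normal v = ⊥⊥⇒∥⨯ (φ⃗ (reverse (Hₐ v))) (twist (Hₐ v)) (φ⃗ v)
    (trans (sym (φ-∙ (reverse (Hₐ v)) v)) (trans (cong φ (H-⊥-reverse v)) φ-0)) (H-⊥-twist v)

  root⇒H-kernel : ∀ {t} → P′ F q a t ≡ 0# → ∃ λ s → Hₐ (s , t , 1#) ≡ 0⃗
  root⇒H-kernel {t} P′t≡0 = s , cong₂ _,_ H₁≡0 (cong₂ _,_ H₂≡0 H₃≡0)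
    where
    open ≡-Reasoning
    φt = φ t
    φ²t = φ φt
    P≡0 : φ²t * φt * t + a * (φ²t * φt) + 1# ≡ 0#
    P≡0 = trans (sym (P′-via-φ t)) P′t≡0
    t≢0 : t ≢ 0#
    t≢0 refl = 1≢0 (trans (sym P′-0) P′t≡0)
    s = proj₁ (divide 1# (φ-≢0 t≢0))
    sφt≡1 = proj₂ (divide 1# (φ-≢0 t≢0))
    φs = φ s
    e₁ : s * φt + 1# ≡ 0#
    e₁ = x≡y⇒x+y≡0 sφt≡1
    e₂ : φs * φ²t + 1# ≡ 0#
    e₂ = x≡y⇒x+y≡0 (trans (φ-*≡ sφt≡1) φ-1)
    H₁≡0 : s * φs + a * s * φt + t * φ 1# ≡ 0#
    H₁≡0 = *-zero-cancelˡ (*-≢0 (φ-≢0 (φ-≢0 t≢0)) (φ-≢0 t≢0)) (begin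
      φ²t * φt * (s * φs + a * s * φt + t * φ 1#)   ≡⟨ cong (λ u → φ²t * φt * (s * φs + a * s * φt + t * u)) φ-1 ⟩
      φ²t * φt * (s * φs + a * s * φt + t * 1#)
        ≡⟨ solve 6 (λ s φs t φt φ²t a → φ²t :* φt :* (s :* φs :+ a :* s :* φt :+ t :* con 1)
             := (φ²t :* φt :* t :+ a :* (φ²t :* φt) :+ con 1)
                :+ (con 1 :+ (φs :* φ²t :+ con 1) :+ a :* φ²t :* φt) :* (s :* φt :+ con 1)
                :+ (φs :* φ²t :+ con 1)) refl s φs t φt φ²t a ⟩
      _ ≡⟨ P≡0 ⊕ _ ⊛ e₁ ⊕ e₂ ⟩
      0#                                            ∎)
    H₂≡0 : s * φt + 1# * φ 1# ≡ 0#
    H₂≡0 = trans (cong (λ u → s * φt + 1# * u) φ-1) (trans (cong (s * φt +_) (*-identityˡ 1#)) e₁)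
    H₃≡0 : φs * 1# + t * φt + a * φt * 1# ≡ 0#
    H₃≡0 = *-zero-cancelˡ (φ-≢0 (φ-≢0 t≢0)) (begin
      φ²t * (φs * 1# + t * φt + a * φt * 1#)
        ≡⟨ solve 5 (λ φs t φt φ²t a → φ²t :* (φs :* con 1 :+ t :* φt :+ a :* φt :* con 1)
             := (φ²t :* φt :* t :+ a :* (φ²t :* φt) :+ con 1) :+ (φs :* φ²t :+ con 1)) refl φs t φt φ²t a ⟩
      _ ≡⟨ P≡0 ⊕ e₂ ⟩
      0#                                            ∎)

  H-kernel-root : ∀ {x y z} → z ≢ 0# → Hₐ (x , y , z) ≡ 0⃗ → ∃ λ t → P′ F q a t ≡ 0#
  H-kernel-root {x} {y} {z} z≢0 Hv≡0 = t , trans (P′-via-φ t) (*-zero-cancelˡ zφzφ²z≢0 (begin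
    z * φz * φ²z * (φ²t * φt * t + a * (φ²t * φt) + 1#)
      ≡⟨ solve 11 (λ t φt φ²t z φz φ²z y φy φ²y φx a →
           z :* φz :* φ²z :* (φ²t :* φt :* t :+ a :* (φ²t :* φt) :+ con 1)
           := φt :* φz :* φ²t :* φ²z :* (t :* z :+ y) :+ (y :* φ²t :* φ²z :+ a :* z :* φ²t :* φ²z) :* (φt :* φz :+ φy)
              :+ (y :* φy :+ a :* z :* φy) :* (φ²t :* φ²z :+ φ²y) :+ z :* (φx :* φ²y :+ φz :* φ²z)
              :+ φ²y :* (φx :* z :+ y :* φy :+ a :* φy :* z))
         refl t φt φ²t z φz φ²z y φy φ²y φx a ⟩
    _ ≡⟨ _ ⊛ x≡y⇒x+y≡0 tz≡y ⊕ _ ⊛ x≡y⇒x+y≡0 (φ-*≡ tz≡y) ⊕ _ ⊛ x≡y⇒x+y≡0 (φ-*≡ (φ-*≡ tz≡y))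
         ⊕ z ⊛ φ-*+*≡0 H₂≡0 ⊕ φ²y ⊛ H₃≡0 ⟩
    0#  ∎))
    where
    open ≡-Reasoning
    t = proj₁ (divide y z≢0)
    tz≡y = proj₂ (divide y z≢0)
    φt = φ t
    φ²t = φ φt
    φz = φ z
    φ²z = φ φz
    φy = φ y
    φ²y = φ φy
    φx = φ x
    zφzφ²z≢0 : z * φz * φ²z ≢ 0#
    zφzφ²z≢0 = *-≢0 (*-≢0 z≢0 (φ-≢0 z≢0)) (φ-≢0 (φ-≢0 z≢0))
    H₂≡0 : x * φy + z * φz ≡ 0#
    H₂≡0 = cong (proj₁ ∘ proj₂) Hv≡0
    H₃≡0 : φx * z + y * φy + a * φy * z ≡ 0#
    H₃≡0 = cong (proj₂ ∘ proj₂) Hv≡0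

  H-kernel-z≡0 : ∀ {x y} → Hₐ (x , y , 0#) ≡ 0⃗ → x ≡ 0# × y ≡ 0#
  H-kernel-z≡0 {x} {y} Hv≡0 = x*φx≡0⇒x≡0 xφx≡0 , x*φx≡0⇒x≡0 yφy≡0
    where
    xφy≡0 : x * φ y ≡ 0#
    xφy≡0 = trans (solve 3 (λ x Y Z → x :* Y := x :* Y :+ con 0 :* Z) refl x (φ y) (φ 0#)) (cong (proj₁ ∘ proj₂) Hv≡0)
    xφx≡0 : x * φ x ≡ 0#
    xφx≡0 = trans (solve 6 (λ x X Y y Z a → x :* X := (x :* X :+ a :* x :* Y :+ y :* Z) :+ a :* (x :* Y) :+ y :* Z)
                    refl x (φ x) (φ y) y (φ 0#) a)
                  (cong proj₁ Hv≡0 ⊕ a ⊛ xφy≡0 ⊕ y ⊛ φ-0)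
    yφy≡0 : y * φ y ≡ 0#
    yφy≡0 = trans (solve 4 (λ y Y X a → y :* Y := X :* con 0 :+ y :* Y :+ a :* Y :* con 0) refl y (φ y) (φ x) a)
                  (cong (proj₂ ∘ proj₂) Hv≡0)

  H-kernel : NoRoot → ∀ {v} → Hₐ v ≡ 0⃗ → v ≡ 0⃗
  H-kernel no-root {x , y , z} Hv≡0 with z ≟ 0#
  ... | no  z≢0 = contradiction (H-kernel-root z≢0 Hv≡0) no-root
  ... | yes refl = let x≡0 , y≡0 = H-kernel-z≡0 Hv≡0 in cong₂ _,_ x≡0 (cong₂ _,_ y≡0 refl)

  L₁ L₂ : Carrier → Carrier
  L₁ X = φ (φ (φ X)) + a * φ (φ X) + X
  L₂ Y = φ (φ (φ Y)) + a * φ Y + Y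

  L₂-+ : ∀ u v → L₂ (u + v) ≡ L₂ u + L₂ v
  L₂-+ u v = begin
    φ (φ (φ (u + v))) + a * φ (u + v) + (u + v)
      ≡⟨ cong₂ (λ s t → s + a * t + (u + v)) (trans (cong (φ ∘ φ) (φ-+ u v)) (trans (cong φ (φ-+ _ _)) (φ-+ _ _))) (φ-+ u v) ⟩
    (φ (φ (φ u)) + φ (φ (φ v))) + a * (φ u + φ v) + (u + v)
      ≡⟨ solve 7 (λ a u v U V U³ V³ → (U³ :+ V³) :+ a :* (U :+ V) :+ (u :+ v) := (U³ :+ a :* U :+ u) :+ (V³ :+ a :* V :+ v))
           refl a u v (φ u) (φ v) (φ (φ (φ u))) (φ (φ (φ v))) ⟩
    L₂ u + L₂ v  ∎
    where open ≡-Reasoning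

  L₂-kernel-root : ∀ {Y} → Y ≢ 0# → L₂ Y ≡ 0# → ∃ λ t → P′ F q a t ≡ 0#
  L₂-kernel-root {Y} Y≢0 L₂Y≡0 = t , trans (P′-via-φ t) (*-zero-cancelˡ (φ-≢0 (φ-≢0 (φ-≢0 Y≢0))) (begin
    φ³Y * (φ²t * φt * t + a * (φ²t * φt) + 1#)
      ≡⟨ solve 8 (λ t φt φ²t Y φY φ²Y φ³Y a →
           φ³Y :* (φ²t :* φt :* t :+ a :* (φ²t :* φt) :+ con 1)
           := (φt :* t :+ a :* φt) :* (φ²t :* φ³Y :+ φ²Y) :+ (t :+ a) :* (φt :* φ²Y :+ φY) :+ (t :* φY :+ Y)
              :+ (φ³Y :+ a :* φY :+ Y))
         refl t φt φ²t Y φY φ²Y φ³Y a ⟩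
    _ ≡⟨ _ ⊛ x≡y⇒x+y≡0 (φ-*≡ (φ-*≡ tφY≡Y)) ⊕ _ ⊛ x≡y⇒x+y≡0 (φ-*≡ tφY≡Y)
         ⊕ x≡y⇒x+y≡0 tφY≡Y ⊕ L₂Y≡0 ⟩
    0#  ∎))
    where
    open ≡-Reasoning
    t = proj₁ (divide Y (φ-≢0 Y≢0))
    tφY≡Y = proj₂ (divide Y (φ-≢0 Y≢0))
    φt = φ t
    φ²t = φ φt
    φY = φ Y
    φ²Y = φ φY
    φ³Y = φ φ²Y

  L₂-injective : NoRoot → Injective _≡_ _≡_ L₂
  L₂-injective no-root {u} {v} L₂u≡L₂v with u + v ≟ 0#
  ... | yes u+v≡0 = x+y≡0⇒x≡y u+v≡0
  ... | no  u+v≢0 = contradiction (L₂-kernel-root u+v≢0 (trans (L₂-+ u v) (x≡y⇒x+y≡0 L₂u≡L₂v))) no-root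

  Tr-φ : ∀ w → Tr (φ w) ≡ Tr w
  Tr-φ = Tr-frobenius i

  Tr-+₃ : ∀ u v w → Tr (u + v + w) ≡ Tr u + Tr v + Tr w
  Tr-+₃ u v w = trans (trace-+ m (u + v) w) (cong (_+ Tr w) (trace-+ m u v))

  trace-adjoint : ∀ X Y → Tr (φ (φ X) * L₂ Y) ≡ Tr (φ (φ (φ Y)) * φ (φ (L₁ X)))
  trace-adjoint X Y = begin
    Tr (φ²X * L₂ Y)
      ≡⟨ cong Tr (solve 4 (λ φ²X φ³Y aφY Y → φ²X :* (φ³Y :+ aφY :+ Y) := φ²X :* φ³Y :+ φ²X :* aφY :+ φ²X :* Y)
                         refl φ²X φ³Y (a * φ Y) Y) ⟩
    Tr (φ²X * φ³Y + φ²X * (a * φ Y) + φ²X * Y)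
      ≡⟨ Tr-+₃ _ _ _ ⟩
    Tr (φ²X * φ³Y) + Tr (φ²X * (a * φ Y)) + Tr (φ²X * Y)
      ≡⟨ cong₂ (λ s t → Tr (φ²X * φ³Y) + s + t) (sym (Tr-φ² _)) (sym (trans (Tr-φ _) (Tr-φ² _))) ⟩
    Tr (φ²X * φ³Y) + Tr (φ² (φ²X * (a * φ Y))) + Tr (φ (φ² (φ²X * Y)))
      ≡⟨ Tr-+₃ _ _ _ ⟨
    Tr (φ²X * φ³Y + φ² (φ²X * (a * φ Y)) + φ (φ² (φ²X * Y)))
      ≡⟨ cong Tr (cong₂ (λ s t → φ²X * φ³Y + s + t) (trans (φ²-* φ²X (a * φ Y)) (cong (φ² φ²X *_) (φ²-* a (φ Y))))
                                                     (trans (cong φ (φ²-* φ²X Y)) (φ-* _ _))) ⟩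
    Tr (φ²X * φ³Y + φ² φ²X * (φ² a * φ³Y) + φ (φ² φ²X) * φ³Y)
      ≡⟨ cong Tr (solve 5 (λ φ²X φ⁴X φ⁵X φ²a φ³Y → φ²X :* φ³Y :+ φ⁴X :* (φ²a :* φ³Y) :+ φ⁵X :* φ³Y
                                                  := φ³Y :* (φ⁵X :+ φ²a :* φ⁴X :+ φ²X))
                         refl φ²X (φ² φ²X) (φ (φ² φ²X)) (φ² a) φ³Y) ⟩
    Tr (φ³Y * (φ (φ² φ²X) + φ² a * φ² φ²X + φ²X))
      ≡⟨ cong (λ s → Tr (φ³Y * s)) φ²-L₁ ⟨
    Tr (φ³Y * φ² (L₁ X))  ∎
    where
    open ≡-Reasoning
    φ² : Carrier → Carrier
    φ² x = φ (φ x)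
    φ²X = φ² X
    φ³Y = φ (φ² Y)
    Tr-φ² : ∀ w → Tr (φ² w) ≡ Tr w
    Tr-φ² w = trans (Tr-φ (φ w)) (Tr-φ w)
    φ²-+ : ∀ x y → φ² (x + y) ≡ φ² x + φ² y
    φ²-+ x y = trans (cong φ (φ-+ x y)) (φ-+ (φ x) (φ y))
    φ²-* : ∀ x y → φ² (x * y) ≡ φ² x * φ² y
    φ²-* x y = trans (cong φ (φ-* x y)) (φ-* (φ x) (φ y))
    φ²-L₁ : φ² (L₁ X) ≡ φ (φ² φ²X) + φ² a * φ² φ²X + φ²X
    φ²-L₁ = trans (φ²-+ _ X) (cong (_+ φ²X) (trans (φ²-+ _ _) (cong (φ (φ² φ²X) +_) (φ²-* a φ²X))))

  L₁-kernel-trivial : NoRoot → ∀ {X} → X ≢ 0# → L₁ X ≢ 0#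
  L₁-kernel-trivial no-root {X} X≢0 L₁X≡0 = Tr-nonvanishing Tr≡0
    where
    φ²X≢0 = φ-≢0 (φ-≢0 X≢0)
    Tr≡0 : ∀ c → Tr c ≡ 0#
    Tr≡0 c = begin
      Tr c                             ≡⟨ cong Tr (proj₂ (divide c φ²X≢0)) ⟨
      Tr (c′ * φ (φ X))                ≡⟨ cong (λ u → Tr (u * φ (φ X))) L₂Y≡c′ ⟨
      Tr (L₂ Y * φ (φ X))              ≡⟨ cong Tr (*-comm (L₂ Y) _) ⟩
      Tr (φ (φ X) * L₂ Y)              ≡⟨ trace-adjoint X Y ⟩
      Tr (φ (φ (φ Y)) * φ (φ (L₁ X)))  ≡⟨ cong (λ u → Tr (φ (φ (φ Y)) * φ (φ u))) L₁X≡0 ⟩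
      Tr (φ (φ (φ Y)) * φ (φ 0#))      ≡⟨ cong (λ u → Tr (φ (φ (φ Y)) * u)) (trans (cong φ φ-0) φ-0) ⟩
      Tr (φ (φ (φ Y)) * 0#)            ≡⟨ cong Tr (zeroʳ _) ⟩
      Tr 0#                            ≡⟨ Tr-0 ⟩
      0#                               ∎
      where
      open ≡-Reasoning
      c′ = proj₁ (divide c φ²X≢0)
      Y = proj₁ (injective⇒surjective (L₂-injective no-root) c′)
      L₂Y≡c′ = proj₂ (injective⇒surjective (L₂-injective no-root) c′)

  normal≡0⇒p₁≢0 : ∀ {p} → Nonzero p → normal p ≡ 0⃗ → proj₁ p ≢ 0#
  normal≡0⇒p₁≢0 {p₁ , p₂ , p₃} p≢0 n≡0 refl = nonzero⇒≢0⃗ p≢0 (cong₂ _,_ refl (cong₂ _,_ p₂≡0 p₃≡0))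
    where
    φ0*≡0 : ∀ x → φ 0# * x ≡ 0#
    φ0*≡0 x = trans (cong (_* x) φ-0) (zeroˡ x)
    p₃≡0 : p₃ ≡ 0#
    p₃≡0 = x*φx≡0⇒x≡0 (trans (*-comm p₃ (φ p₃)) (x≡0⇒x+y≡0⇒y≡0 (φ0*≡0 p₂) (cong (proj₁ ∘ proj₂) n≡0)))
    p₂≡0 : p₂ ≡ 0#
    p₂≡0 = x*φx≡0⇒x≡0 (trans (*-comm p₂ (φ p₂)) (x≡0⇒x+y≡0⇒y≡0 (trans (cong (λ u → φ u * _) p₃≡0) (φ0*≡0 _))
                                                                (cong (proj₂ ∘ proj₂) n≡0)))

  normal≡0⇒p₃≢0 : ∀ {p₁ p₂ p₃} → p₁ ≢ 0# → normal (p₁ , p₂ , p₃) ≡ 0⃗ → p₃ ≢ 0#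
  normal≡0⇒p₃≢0 {p₁} {p₂} p₁≢0 n≡0 refl = p₁≢0 (y≡0⇒x+y≡0⇒x≡0 (trans (cong (a *_) p₂≡0) (zeroʳ a)) p₁+ap₂≡0)
    where
    p₂≡0 : p₂ ≡ 0#
    p₂≡0 = *-zero-cancelˡ (φ-≢0 p₁≢0) (y≡0⇒x+y≡0⇒x≡0 (zeroʳ _) (cong (proj₁ ∘ proj₂) n≡0))
    p₁+ap₂≡0 : p₁ + a * p₂ ≡ 0#
    p₁+ap₂≡0 = *-zero-cancelˡ (φ-≢0 p₁≢0) (x≡0⇒x+y≡0⇒y≡0 (zeroʳ _) (cong proj₁ n≡0))

  normal≡0⇒L₁-root : ∀ {p₁ p₂ p₃ X} → p₁ ≢ 0# → normal (p₁ , p₂ , p₃) ≡ 0⃗ →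
                     φ X * p₁ ≡ X * p₃ → L₁ X ≡ 0#
  normal≡0⇒L₁-root {p₁} {p₂} {p₃} {X} p₁≢0 n≡0 φX*p₁≡X*p₃ = *-zero-cancelˡ p₁φp₁φ²p₁≢0 (begin
    p₁ * φp₁ * φ²p₁ * L₁ X
      ≡⟨ solve 13 (λ X φX φ²X φ³X p₁ p₂ p₃ φp₁ φp₂ φp₃ φ²p₁ φ²p₃ a →
           p₁ :* φp₁ :* φ²p₁ :* (φ³X :+ a :* φ²X :+ X)
           := φp₁ :* p₁ :* (φ³X :* φ²p₁ :+ φ²X :* φ²p₃)
              :+ (φ²p₃ :* p₁ :+ a :* φ²p₁ :* p₁) :* (φ²X :* φp₁ :+ φX :* φp₃)
              :+ (φp₃ :* φ²p₃ :+ a :* φ²p₁ :* φp₃) :* (φX :* p₁ :+ X :* p₃)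
              :+ X :* a :* φ²p₁ :* (φp₁ :* p₂ :+ φp₃ :* p₃)
              :+ X :* φ²p₁ :* (φp₂ :* p₃ :+ φp₁ :* (p₁ :+ a :* p₂))
              :+ X :* p₃ :* (φ²p₁ :* φp₂ :+ φ²p₃ :* φp₃))
         refl X (φ X) (φ (φ X)) (φ (φ (φ X))) p₁ p₂ p₃ φp₁ (φ p₂) φp₃ φ²p₁ (φ φp₃) a ⟩
    _ ≡⟨ _ ⊛ φ-*+*≡0 (φ-*+*≡0 d) ⊕ _ ⊛ φ-*+*≡0 d ⊕ _ ⊛ d
         ⊕ _ ⊛ n₂≡0 ⊕ _ ⊛ cong proj₁ n≡0 ⊕ _ ⊛ φ-*+*≡0 n₂≡0 ⟩
    0#  ∎)
    where
    open ≡-Reasoning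
    φp₁ = φ p₁
    φ²p₁ = φ φp₁
    φp₃ = φ p₃
    p₁φp₁φ²p₁≢0 : p₁ * φp₁ * φ²p₁ ≢ 0#
    p₁φp₁φ²p₁≢0 = *-≢0 (*-≢0 p₁≢0 (φ-≢0 p₁≢0)) (φ-≢0 (φ-≢0 p₁≢0))
    d : φ X * p₁ + X * p₃ ≡ 0#
    d = x≡y⇒x+y≡0 φX*p₁≡X*p₃
    n₂≡0 : φp₁ * p₂ + φp₃ * p₃ ≡ 0#
    n₂≡0 = cong (proj₁ ∘ proj₂) n≡0

  φ²-fixed⇒≡1 : gcd (2 ℕ.* i) m ≡ 1 → ∀ {x} → x ≢ 0# → φ (φ x) ≡ x → x ≡ 1#
  φ²-fixed⇒≡1 2i⊥m {x} x≢0 φφx≡x = fixed-coprime⇒≡1 {2 ℕ.* i} 2i⊥m x≢0 (mkFixed (begin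
    x ^ (2 ℕ.^ (2 ℕ.* i))    ≡⟨ cong (λ k → x ^ (2 ℕ.^ (i ℕ.+ k))) (ℕ.+-identityʳ i) ⟩
    x ^ (2 ℕ.^ (i ℕ.+ i))    ≡⟨ cong (x ^_) (ℕ.^-distribˡ-+-* 2 i i) ⟩
    x ^ (q ℕ.* q)            ≡⟨ ^-*-assoc x q q ⟨
    φ (φ x)                  ≡⟨ φφx≡x ⟩
    x                        ∎))
    where open ≡-Reasoning

  l*φl≡1⇒l≡1 : gcd (2 ℕ.* i) m ≡ 1 → ∀ {l} → l * φ l ≡ 1# → l ≡ 1#
  l*φl≡1⇒l≡1 2i⊥m {l} lφl≡1 = φ²-fixed⇒≡1 2i⊥m l≢0 (*-cancelˡ (φ-≢0 l≢0) (begin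
    φ l * φ (φ l)   ≡⟨ φ-*≡ lφl≡1 ⟩
    φ 1#            ≡⟨ φ-1 ⟩
    1#              ≡⟨ lφl≡1 ⟨
    l * φ l         ≡⟨ *-comm l (φ l) ⟩
    φ l * l         ∎))
    where
    open ≡-Reasoning
    l≢0 : l ≢ 0#
    l≢0 refl = 1≢0 (trans (sym lφl≡1) (zeroˡ _))

  module _ (i≢0 : i ≢ 0) (2i⊥m : gcd (2 ℕ.* i) m ≡ 1) where

    private
      ψ : Carrier → Carrier
      ψ X = X ^ (q ℕ.∸ 1)

      φ≡*ψ : ∀ X → φ X ≡ X * ψ X
      φ≡*ψ X = cong (X ^_) (sym (ℕ.m+[n∸m]≡n (ℕ.m^n>0 2 i)))

      ψ-0 : ψ 0# ≡ 0#
      ψ-0 with q ℕ.∸ 1 | ℕ.m<n⇒0<n∸m (ℕ.^-monoʳ-≤ 2 (ℕ.n≢0⇒n>0 i≢0))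
      ... | suc _ | _ = zeroˡ _

      ψ-injective : Injective _≡_ _≡_ ψ
      ψ-injective {X} {Y} ψX≡ψY with X ≟ 0# | Y ≟ 0#
      ... | yes refl | yes refl = refl
      ... | yes refl | no  Y≢0  = contradiction (trans (sym ψX≡ψY) ψ-0) (^-≢0 (q ℕ.∸ 1) Y≢0)
      ... | no  X≢0  | yes refl = contradiction (trans ψX≡ψY ψ-0) (^-≢0 (q ℕ.∸ 1) X≢0)
      ... | no  X≢0  | no  Y≢0  = trans (sym lY≡X) (trans (cong (_* Y) l≡1) (*-identityˡ Y))
        where
        l = proj₁ (divide X Y≢0)
        lY≡X = proj₂ (divide X Y≢0)
        l≢0 : l ≢ 0#
        l≢0 l≡0 = X≢0 (trans (sym lY≡X) (trans (cong (_* Y) l≡0) (zeroˡ Y)))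
        ψl≡1 : ψ l ≡ 1#
        ψl≡1 = *-cancelˡ (^-≢0 (q ℕ.∸ 1) Y≢0) (begin
          ψ Y * ψ l    ≡⟨ *-comm (ψ Y) (ψ l) ⟩
          ψ l * ψ Y    ≡⟨ ^-distribʳ-* l Y (q ℕ.∸ 1) ⟨
          ψ (l * Y)    ≡⟨ cong ψ lY≡X ⟩
          ψ X          ≡⟨ ψX≡ψY ⟩
          ψ Y          ≡⟨ *-identityʳ (ψ Y) ⟨
          ψ Y * 1#     ∎)
          where open ≡-Reasoning
        l≡1 : l ≡ 1#
        l≡1 = φ²-fixed⇒≡1 2i⊥m l≢0 (trans (cong φ φl≡l) φl≡l)
          where
          φl≡l : φ l ≡ l
          φl≡l = trans (φ≡*ψ l) (trans (cong (l *_) ψl≡1) (*-identityʳ l))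

    φ-eigenvector : ∀ {u} → u ≢ 0# → ∃ λ X → X ≢ 0# × φ X ≡ X * u
    φ-eigenvector {u} u≢0 = X , X≢0 , trans (φ≡*ψ X) (cong (X *_) ψX≡u)
      where
      X = proj₁ (injective⇒surjective ψ-injective u)
      ψX≡u = proj₂ (injective⇒surjective ψ-injective u)
      X≢0 : X ≢ 0#
      X≢0 X≡0 = u≢0 (trans (sym ψX≡u) (trans (cong ψ X≡0) ψ-0))

    normal-nonvanishing : NoRoot → ∀ {p} → Nonzero p → normal p ≢ 0⃗
    normal-nonvanishing no-root {p₁ , p₂ , p₃} p≢0 n≡0 =
      L₁-kernel-trivial no-root X≢0 (normal≡0⇒L₁-root p₁≢0 n≡0 φX*p₁≡X*p₃)
      where
      p₁≢0 = normal≡0⇒p₁≢0 p≢0 n≡0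
      u = proj₁ (divide p₃ p₁≢0)
      up₁≡p₃ = proj₂ (divide p₃ p₁≢0)
      u≢0 : u ≢ 0#
      u≢0 u≡0 = normal≡0⇒p₃≢0 p₁≢0 n≡0 (trans (sym up₁≡p₃) (trans (cong (_* p₁) u≡0) (zeroˡ p₁)))
      X = proj₁ (φ-eigenvector u≢0)
      X≢0 = proj₁ (proj₂ (φ-eigenvector u≢0))
      φX*p₁≡X*p₃ : φ X * p₁ ≡ X * p₃
      φX*p₁≡X*p₃ = trans (cong (_* p₁) (proj₂ (proj₂ (φ-eigenvector u≢0))))
                         (trans (*-assoc X u p₁) (cong (X *_) up₁≡p₃))

    H-injective : NoRoot → Injective _≡_ _≡_ Hₐ
    H-injective no-root {v} {w} Hv≡Hw with Hₐ v ≟³ 0⃗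
    ... | yes Hv≡0 = trans (H-kernel no-root Hv≡0) (sym (H-kernel no-root (trans (sym Hv≡Hw) Hv≡0)))
    ... | no  Hv≢0 = begin
      v              ≡⟨ *ᵛ-identityˡ v ⟨
      1# *ᵛ v        ≡⟨ cong (_*ᵛ v) l≡1 ⟨
      l *ᵛ v         ≡⟨ w≡lv ⟨
      w              ∎
      where
      open ≡-Reasoning
      Hv≠0 = ≢0⃗⇒Nonzero Hv≢0
      v∥w : v ∥ w
      v∥w = φ⃗-∥ (∥-trans (≢0⃗⇒Nonzero (normal-nonvanishing no-root Hv≠0))
                         (φ⃗-∥-normal v) (subst (λ p → φ⃗ w ∥ normal p) (sym Hv≡Hw) (φ⃗-∥-normal w)))
      v≠0 : Nonzero v
      v≠0 = ≢0⃗⇒Nonzero (λ v≡0 → Hv≢0 (trans (cong Hₐ v≡0) H-0⃗))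
      l = proj₁ (∥⇒*ᵛ v≠0 v∥w)
      w≡lv = proj₂ (∥⇒*ᵛ v≠0 v∥w)
      l≡1 : l ≡ 1#
      l≡1 = l*φl≡1⇒l≡1 2i⊥m (*ᵛ-identity-unique Hv≠0
              (trans (sym (H-homogeneous l v)) (trans (cong Hₐ (sym w≡lv)) (sym Hv≡Hw))))

open import Data.Nat using (_^_)

theorem3p3 : (m i : ℕ) → 3 ≤ m → ¬ (2 ∣ m) → gcd i m ≡ 1 →
    (F : Field) → HasOrder F (2 ^ m) →
    (a : Field.Carrier F) → ¬ (a ≡ Field.0# F) →
    Bijective {A = Field.Carrier F × Field.Carrier F × Field.Carrier F} _≡_ _≡_ (H F (2 ^ i) a)
      ⇔ (¬ ∃ λ (t : Field.Carrier F) → P′ F (2 ^ i) a t ≡ Field.0# F)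
theorem3p3 m i 3≤m 2∤m i⊥m F order a _ = mk⇔ bijective⇒no-root no-root⇒bijective
  where
  open PermutationCriterion F m order i a
  i≢0 : i ≢ 0
  i≢0 refl = contradiction (subst (3 ≤_) (trans (sym (gcd-identityˡ m)) i⊥m) 3≤m) λ { (ℕ.s≤s ()) }
  2i⊥m : gcd (2 ℕ.* i) m ≡ 1
  2i⊥m = coprime⇒gcd≡1 (coprime-2* {i} 2∤m (gcd≡1⇒coprime i⊥m))
  bijective⇒no-root : Bijective _≡_ _≡_ Hₐ → NoRoot
  bijective⇒no-root (injective , _) (t , P′t≡0) =
    let _ , H[s,t,1]≡0 = root⇒H-kernel P′t≡0 in
    1≢0 (cong (proj₂ ∘ proj₂) (injective (trans H[s,t,1]≡0 (sym H-0⃗))))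
  no-root⇒bijective : NoRoot → Bijective _≡_ _≡_ Hₐ
  no-root⇒bijective no-root =
    H-injective i≢0 2i⊥m no-root ,
    strictlySurjective⇒surjective (finite-injective⇒surjective (↔Fin-³ order) (H-injective i≢0 2i⊥m no-root))
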